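{- Let $K_{n_1,n_2,\dots,n_k}$ be a complete multipartite graph with $2\leq n_k\leq n_{k-1}\leq\dots\leq n_2\leq n_1$, and let $n=n_1+\dots+n_k$ be its number of vertices. Then $b_t(K_{n_1,n_2,\dots,n_k})\leq 4n-2n_1-2$.
   Context: The complete multipartite graph $K_{n_1,\dots,n_k}$ has vertex set the disjoint union of sets $V_1,\dots,V_k$ with $|V_i|=n_i$, and two vertices are adjacent iff they lie in different sets $V_i\neq V_j$. For a graph $G$ without isolated vertices, a set $D\subseteq V(G)$ is a total dominating set if every vertex $v\in V(G)$ has a neighbor in $D$; $\gamma_t(G)$ is the minimum cardinality of a total dominating set. A total bondage edge set is a set $B\subseteq E(G)$ such that $G-B$ has no isolated vertices and $\gamma_t(G-B)>\gamma_t(G)$. The total bondage number $b_t(G)$ is the minimum cardinality of a total bondage edge set of $G$, and $b_t(G)=\infty$ if no total bondage edge set exists. -}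

module Defs where

open import Data.Nat using (ℕ; _≤_; _<_)
open import Data.Fin using (Fin)
open import Data.Product using (Σ; ∃; _×_; _,_)
open import Data.Sum using (_⊎_)
open import Data.List using (List; length; tabulate)
open import Data.Nat.ListAction using (sum)
open import Data.List.Membership.Propositional using (_∈_)
open import Data.List.Relation.Unary.All using (All)
open import Data.List.Relation.Unary.Unique.Propositional using (Unique)
open import Data.List.Relation.Unary.AllPairs using (AllPairs)
open import Relation.Binary.PropositionalEquality using (_≡_)
open import Relation.Nullary using (¬_)

-- A (simple, undirected) graph on a vertex type V is given by its
-- adjacency relation (symmetric, irreflexive in all uses below).
Graph : Set → Set₁
Graph V = V → V → Set

KVertex : (k : ℕ) → (Fin k → ℕ) → Set
KVertex k ns = Σ (Fin k) (λ i → Fin (ns i))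

KAdj : (k : ℕ) (ns : Fin k → ℕ) → Graph (KVertex k ns)
KAdj k ns (i , _) (j , _) = ¬ (i ≡ j)

module _ {V : Set} where

  NoIsolated : Graph V → Set
  NoIsolated G = ∀ v → ∃ λ u → G v u

  IsTDS : Graph V → List V → Set
  IsTDS G D = ∀ v → ∃ λ d → d ∈ D × G v d

  IsGammaT : Graph V → ℕ → Set
  IsGammaT G m =
    (∃ λ D → Unique D × IsTDS G D × length D ≡ m) ×
    (∀ D → Unique D → IsTDS G D → m ≤ length D)

  SameEdge : V × V → V × V → Set
  SameEdge (a , b) (c , d) = (a ≡ c × b ≡ d) ⊎ (a ≡ d × b ≡ c)

  IsEdgeSet : Graph V → List (V × V) → Set
  IsEdgeSet G B = All (λ e → G (Data.Product.proj₁ e) (Data.Product.proj₂ e)) B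
                × AllPairs (λ e f → ¬ SameEdge e f) B

  RemoveEdges : Graph V → List (V × V) → Graph V
  RemoveEdges G B u v = G u v × ¬ ((u , v) ∈ B) × ¬ ((v , u) ∈ B)

  IsTotalBondageSet : Graph V → List (V × V) → Set
  IsTotalBondageSet G B =
    IsEdgeSet G B ×
    NoIsolated (RemoveEdges G B) ×
    (∀ m m' → IsGammaT G m → IsGammaT (RemoveEdges G B) m' → m < m')

  -- b_t(G) ≤ c  (b_t(G) = ∞ when no total bondage set exists, so this
  -- holds iff some total bondage edge set has cardinality ≤ c)
  TotalBondageAtMost : Graph V → ℕ → Set
  TotalBondageAtMost G c = ∃ λ B → IsTotalBondageSet G B × length B ≤ c

numVertices : (k : ℕ) → (Fin k → ℕ) → ℕ
numVertices k ns = sum (tabulate ns)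

{-# OPTIONS --safe #-}
-- Pick x and y in the first two parts and delete every edge at x or at y except xy.
-- Then x and y are each other's only neighbours, so every total dominating set of the
-- new graph contains both of them, plus a third vertex dominating a second vertex x′ of
-- x's part, which is adjacent to neither. As {x, y} totally dominates K, γ_t grows from
-- at most 2 to at least 3, at the price of at most 2n deleted edges; and
-- 2n ≤ 4n − 2n₁ − 2 because n₁ < n.
module Submission where

open import Defs
open import Data.Nat using (ℕ; suc; _≤_; _*_; _∸_)
open import Data.Fin using (Fin; zero) renaming (_≤_ to _≤ᶠ_)

open import Data.Nat using (zero; _+_; _<_; s≤s; z≤n)
open import Data.Nat.Properties
  using (module ≤-Reasoning; ≤-trans; ≤-reflexive; ≤-<-trans; +-mono-≤; +-monoʳ-≤; *-monoʳ-≤;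
         +-comm; +-assoc; *-suc; ∸-+-assoc; m+n≤o⇒m≤o∸n; m<m+n; m≤m+n)
open import Data.Fin using (suc; _≟_)
open import Data.Product using (∃; _×_; _,_; proj₁; proj₂)
open import Data.Product.Properties using (≡-dec)
open import Data.Sum using (_⊎_; inj₁; inj₂)
open import Data.Empty using (⊥-elim)
open import Data.List using (List; []; _∷_; _++_; map; filter; allFin; length; removeAt)
open import Data.List.Properties using (length-++; length-map; length-filter; length-tabulate; length-removeAt′)
open import Data.List.Membership.Propositional using (_∈_; _∉_)
open import Data.List.Membership.Propositional.Properties
  using (∈-map⁺; ∈-map⁻; ∈-++⁺ˡ; ∈-++⁺ʳ; ∈-++⁻; ∈-allFin; ∈-filter⁺; ∈-filter⁻)
open import Data.List.Relation.Binary.Disjoint.Propositional using (Disjoint)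
open import Data.List.Relation.Binary.Subset.Propositional using (_⊆_)
open import Data.List.Relation.Unary.Any using (here; there; index)
open import Data.List.Relation.Unary.All as All using (All; []; _∷_)
import Data.List.Relation.Unary.All.Properties as All
open import Data.List.Relation.Unary.AllPairs as AllPairs using (AllPairs; []; _∷_)
import Data.List.Relation.Unary.AllPairs.Properties as AllPairs
open import Data.List.Relation.Unary.Unique.Propositional using (Unique)
import Data.List.Relation.Unary.Unique.Propositional.Properties as Unique
open import Function using (_∘_)
open import Relation.Binary.Definitions using (Decidable; DecidableEquality)
open import Relation.Binary.PropositionalEquality
open import Relation.Nullary using (¬_; Dec; yes; no)
open import Relation.Nullary.Decidable using (¬?; _×-dec_; decidable-stable)

module _ {A : Set} where

  ∈-removeAt : ∀ {a b : A} {ys} (a∈ys : a ∈ ys) → b ∈ ys → b ≢ a → b ∈ removeAt ys (index a∈ys)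
  ∈-removeAt (here refl) (here refl) b≢a = ⊥-elim (b≢a refl)
  ∈-removeAt (here refl) (there b∈ys) _  = b∈ys
  ∈-removeAt (there _)   (here refl)  _  = here refl
  ∈-removeAt (there a∈ys) (there b∈ys) b≢a = there (∈-removeAt a∈ys b∈ys b≢a)

  Unique∧⊆⇒length≤ : ∀ {xs ys : List A} → Unique xs → xs ⊆ ys → length xs ≤ length ys
  Unique∧⊆⇒length≤ [] _ = z≤n
  Unique∧⊆⇒length≤ {x ∷ xs} {ys} (x∉xs ∷ xs!) xs⊆ys = begin
    suc (length xs)                         ≤⟨ s≤s (Unique∧⊆⇒length≤ xs! xs⊆ys⁻) ⟩
    suc (length (removeAt ys (index x∈ys))) ≡⟨ length-removeAt′ ys (index x∈ys) ⟨
    length ys                               ∎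
    where
    open ≤-Reasoning
    x∈ys : x ∈ ys
    x∈ys = xs⊆ys (here refl)
    xs⊆ys⁻ : xs ⊆ removeAt ys (index x∈ys)
    xs⊆ys⁻ z∈xs = ∈-removeAt x∈ys (xs⊆ys (there z∈xs)) (≢-sym (All.lookup x∉xs z∈xs))

module _ {V : Set} where

  unique-neighbour∈TDS : ∀ {H : Graph V} {D u v} → IsTDS H D → (∀ w → H v w → w ≡ u) → u ∈ D
  unique-neighbour∈TDS {D = D} {v = v} tds N[v]⊆u with tds v
  ... | d , d∈D , vd = subst (_∈ D) (N[v]⊆u d vd) d∈D

  3≤length-TDS : ∀ {H : Graph V} {x y z D} → x ≢ y →
                 (∀ w → H x w → w ≡ y) → (∀ w → H y w → w ≡ x) →
                 ¬ H z x → ¬ H z y → IsTDS H D → 3 ≤ length D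
  3≤length-TDS {x = x} {y} {z} {D} x≢y N[x]⊆y N[y]⊆x z≁x z≁y tds with tds z
  ... | d , d∈D , zd = Unique∧⊆⇒length≤ distinct xyd⊆D
    where
    x≢d : x ≢ d
    x≢d refl = z≁x zd
    y≢d : y ≢ d
    y≢d refl = z≁y zd
    distinct : Unique (x ∷ y ∷ d ∷ [])
    distinct = (x≢y ∷ x≢d ∷ []) ∷ (y≢d ∷ []) ∷ [] ∷ []
    xyd⊆D : (x ∷ y ∷ d ∷ []) ⊆ D
    xyd⊆D (here refl)                 = unique-neighbour∈TDS tds N[y]⊆x
    xyd⊆D (there (here refl))         = unique-neighbour∈TDS tds N[x]⊆y
    xyd⊆D (there (there (here refl))) = d∈D

  γₜ-< : ∀ {G H : Graph V} {D} → Unique D → IsTDS G D →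
         (∀ D′ → IsTDS H D′ → length D < length D′) →
         ∀ m m′ → IsGammaT G m → IsGammaT H m′ → m < m′
  γₜ-< D! tds longer m m′ (_ , minimal) ((D′ , _ , tds′ , refl) , _) =
    ≤-<-trans (minimal _ D! tds) (longer D′ tds′)

module IsolateEdge {V : Set} (_≟ᵛ_ : DecidableEquality V) {G : Graph V} (G? : Decidable G)
                   {vs : List V} (vs-complete : ∀ v → v ∈ vs) (vs-unique : Unique vs)
                   {x y : V} (x≢y : x ≢ y) where

  OtherNeighbour : V → V → V → Set
  OtherNeighbour u v w = G u w × w ≢ v

  otherNeighbour? : ∀ u v w → Dec (OtherNeighbour u v w)
  otherNeighbour? u v w = G? u w ×-dec ¬? (w ≟ᵛ v)

  spokes : V → V → List (V × V)
  spokes u v = map (u ,_) (filter (otherNeighbour? u v) vs)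

  cut : List (V × V)
  cut = spokes x y ++ spokes y x

  G⁻ : Graph V
  G⁻ = RemoveEdges G cut

  ∈-spokes⁺ : ∀ {u v w} → G u w → w ≢ v → (u , w) ∈ spokes u v
  ∈-spokes⁺ uw w≢v = ∈-map⁺ _ (∈-filter⁺ (otherNeighbour? _ _) (vs-complete _) (uw , w≢v))

  ∈-spokes⁻ : ∀ {u v a w} → (a , w) ∈ spokes u v → a ≡ u × w ≢ v
  ∈-spokes⁻ {u} {v} p with ∈-map⁻ _ p
  ... | w , w∈ , refl = refl , proj₂ (proj₂ (∈-filter⁻ (otherNeighbour? u v) {xs = vs} w∈))

  ∈-cut⁻ : ∀ {u w} → (u , w) ∈ cut → (u ≡ x × w ≢ y) ⊎ (u ≡ y × w ≢ x)
  ∈-cut⁻ p with ∈-++⁻ (spokes x y) p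
  ... | inj₁ q = inj₁ (∈-spokes⁻ q)
  ... | inj₂ q = inj₂ (∈-spokes⁻ q)

  xy∉cut : (x , y) ∉ cut
  xy∉cut p with ∈-cut⁻ p
  ... | inj₁ (_ , y≢y) = y≢y refl
  ... | inj₂ (x≡y , _) = x≢y x≡y

  yx∉cut : (y , x) ∉ cut
  yx∉cut p with ∈-cut⁻ p
  ... | inj₁ (y≡x , _) = x≢y (sym y≡x)
  ... | inj₂ (_ , x≢x) = x≢x refl

  away∉cut : ∀ {u w} → u ≢ x → u ≢ y → (u , w) ∉ cut
  away∉cut u≢x u≢y p with ∈-cut⁻ p
  ... | inj₁ (u≡x , _) = u≢x u≡x
  ... | inj₂ (u≡y , _) = u≢y u≡y

  N⁻[x]⊆y : ∀ w → G⁻ x w → w ≡ y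
  N⁻[x]⊆y w (xw , xw∉cut , _) =
    decidable-stable (w ≟ᵛ y) (λ w≢y → xw∉cut (∈-++⁺ˡ (∈-spokes⁺ xw w≢y)))

  N⁻[y]⊆x : ∀ w → G⁻ y w → w ≡ x
  N⁻[y]⊆x w (yw , yw∉cut , _) =
    decidable-stable (w ≟ᵛ x) (λ w≢x → yw∉cut (∈-++⁺ʳ (spokes x y) (∈-spokes⁺ yw w≢x)))

  y-spoke-cut : ∀ {z} → G y z → z ≢ x → ¬ G⁻ z y
  y-spoke-cut yz z≢x (_ , _ , yz∉cut) = yz∉cut (∈-++⁺ʳ (spokes x y) (∈-spokes⁺ yz z≢x))

  noIsolated : G x y → G y x → (∀ v → ∃ λ w → G v w × w ≢ x × w ≢ y) → NoIsolated G⁻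
  noIsolated xy yx away v with v ≟ᵛ x | v ≟ᵛ y
  ... | yes refl | _        = y , xy , xy∉cut , yx∉cut
  ... | no _     | yes refl = x , yx , yx∉cut , xy∉cut
  ... | no v≢x   | no v≢y with away v
  ...   | w , vw , w≢x , w≢y = w , vw , away∉cut v≢x v≢y , away∉cut w≢x w≢y

  isEdgeSet : IsEdgeSet G cut
  isEdgeSet = All.++⁺ (spokes-edges x y) (spokes-edges y x)
            , AllPairs.++⁺ (spokes-distinct x y) (spokes-distinct y x) across
    where
    spokes-edges : ∀ u v → All (λ e → G (proj₁ e) (proj₂ e)) (spokes u v)
    spokes-edges u v = All.map⁺ (All.map proj₁ (All.all-filter (otherNeighbour? u v) vs))

    spokes-distinct : ∀ u v → AllPairs (λ e f → ¬ SameEdge e f) (spokes u v)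
    spokes-distinct u v =
      AllPairs.map⁺ (AllPairs.map sameCentre (Unique.filter⁺ (otherNeighbour? u v) vs-unique))
      where
      sameCentre : ∀ {a b} → a ≢ b → ¬ SameEdge (u , a) (u , b)
      sameCentre a≢b (inj₁ (_ , a≡b))   = a≢b a≡b
      sameCentre a≢b (inj₂ (u≡b , a≡u)) = a≢b (trans a≡u u≡b)

    crossing : ∀ {a b} → a ≢ y → ¬ SameEdge (x , a) (y , b)
    crossing _   (inj₁ (x≡y , _)) = x≢y x≡y
    crossing a≢y (inj₂ (_ , a≡y)) = a≢y a≡y

    across : All (λ e → All (λ f → ¬ SameEdge e f) (spokes y x)) (spokes x y)
    across = All.map⁺ (All.map (λ (_ , a≢y) → All.map⁺ (All.universal (λ _ → crossing a≢y) _))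
                               (All.all-filter (otherNeighbour? x y) vs))

  length-cut : length cut ≤ length vs + length vs
  length-cut = ≤-trans (≤-reflexive (length-++ (spokes x y)))
                       (+-mono-≤ (length-spokes x y) (length-spokes y x))
    where
    length-spokes : ∀ u v → length (spokes u v) ≤ length vs
    length-spokes u v = ≤-trans (≤-reflexive (length-map _ (filter (otherNeighbour? u v) vs)))
                                (length-filter (otherNeighbour? u v) vs)

  isTotalBondageSet : G x y → G y x → (∀ v → ∃ λ w → G v w × w ≢ x × w ≢ y) →
                      IsTDS G (x ∷ y ∷ []) →
                      ∀ {z} → ¬ G z x → G y z → z ≢ x → IsTotalBondageSet G cut
  isTotalBondageSet xy yx away tds z≁x yz z≢x =
    isEdgeSet , noIsolated xy yx away , γₜ-< ((x≢y ∷ []) ∷ [] ∷ []) tds longer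
    where
    longer : ∀ D → IsTDS G⁻ D → 2 < length D
    longer D = 3≤length-TDS x≢y N⁻[x]⊆y N⁻[y]⊆x (z≁x ∘ proj₁) (y-spoke-cut yz z≢x)

module _ {k : ℕ} {ns : Fin (suc k) → ℕ} where

  inFirstPart : Fin (ns zero) → KVertex (suc k) ns
  inFirstPart a = zero , a

  inLaterPart : KVertex k (ns ∘ suc) → KVertex (suc k) ns
  inLaterPart (i , a) = suc i , a

vertices : (k : ℕ) (ns : Fin k → ℕ) → List (KVertex k ns)
vertices zero    ns = []
vertices (suc k) ns = map inFirstPart (allFin (ns zero)) ++ map inLaterPart (vertices k (ns ∘ suc))

∈-vertices : ∀ k ns (v : KVertex k ns) → v ∈ vertices k ns
∈-vertices (suc k) ns (zero , a)  = ∈-++⁺ˡ (∈-map⁺ inFirstPart (∈-allFin a))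
∈-vertices (suc k) ns (suc i , a) =
  ∈-++⁺ʳ (map inFirstPart (allFin (ns zero))) (∈-map⁺ inLaterPart (∈-vertices k (ns ∘ suc) (i , a)))

vertices-unique : ∀ k ns → Unique (vertices k ns)
vertices-unique zero    ns = []
vertices-unique (suc k) ns =
  Unique.++⁺ (Unique.map⁺ inFirstPart-injective (Unique.allFin⁺ (ns zero)))
             (Unique.map⁺ inLaterPart-injective (vertices-unique k (ns ∘ suc)))
             parts-disjoint
  where
  inFirstPart-injective : ∀ {a b} → inFirstPart {ns = ns} a ≡ inFirstPart b → a ≡ b
  inFirstPart-injective refl = refl
  inLaterPart-injective : ∀ {v w} → inLaterPart {ns = ns} v ≡ inLaterPart w → v ≡ w
  inLaterPart-injective {_ , _} {_ , _} refl = refl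
  parts-disjoint : Disjoint (map inFirstPart (allFin (ns zero))) (map inLaterPart (vertices k (ns ∘ suc)))
  parts-disjoint (p , q) with ∈-map⁻ inFirstPart p | ∈-map⁻ inLaterPart q
  ... | _ , _ , refl | (_ , _) , _ , ()

length-vertices : ∀ k ns → length (vertices k ns) ≡ numVertices k ns
length-vertices zero    ns = refl
length-vertices (suc k) ns = begin
  length (firstPart ++ laterParts)        ≡⟨ length-++ firstPart ⟩
  length firstPart + length laterParts    ≡⟨ cong₂ _+_ length-firstPart length-laterParts ⟩
  numVertices (suc k) ns                  ∎
  where
  open ≡-Reasoning
  firstPart : List (KVertex (suc k) ns)
  firstPart = map inFirstPart (allFin (ns zero))
  laterParts : List (KVertex (suc k) ns)
  laterParts = map inLaterPart (vertices k (ns ∘ suc))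
  length-firstPart : length firstPart ≡ ns zero
  length-firstPart = trans (length-map _ (allFin (ns zero))) (length-tabulate {n = ns zero} (λ a → a))
  length-laterParts : length laterParts ≡ numVertices k (ns ∘ suc)
  length-laterParts = trans (length-map _ (vertices k (ns ∘ suc))) (length-vertices k (ns ∘ suc))

KAdj? : ∀ k ns → Decidable (KAdj k ns)
KAdj? k ns (i , _) (j , _) = ¬? (i ≟ j)

module _ {n : ℕ} where

  index₀ index₁ : 2 ≤ n → Fin n
  index₀ (s≤s (s≤s _)) = zero
  index₁ (s≤s (s≤s _)) = suc zero

  index₀≢index₁ : (2≤n : 2 ≤ n) → index₀ 2≤n ≢ index₁ 2≤n
  index₀≢index₁ (s≤s (s≤s _)) ()

module TwoLargeParts {k : ℕ} (ns : Fin (suc (suc k)) → ℕ)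
                     (2≤ns₀ : 2 ≤ ns zero) (2≤ns₁ : 2 ≤ ns (suc zero)) where

  K : Graph (KVertex (suc (suc k)) ns)
  K = KAdj (suc (suc k)) ns

  x x′ y y′ : KVertex (suc (suc k)) ns
  x  = zero , index₀ 2≤ns₀
  x′ = zero , index₁ 2≤ns₀
  y  = suc zero , index₀ 2≤ns₁
  y′ = suc zero , index₁ 2≤ns₁

  index-injective : ∀ {i} {a b : Fin (ns i)} → _≡_ {A = KVertex (suc (suc k)) ns} (i , a) (i , b) → a ≡ b
  index-injective refl = refl

  x≢y : x ≢ y
  x≢y ()

  x′≢x : x′ ≢ x
  x′≢x = index₀≢index₁ 2≤ns₀ ∘ sym ∘ index-injective

  y′≢y : y′ ≢ y
  y′≢y = index₀≢index₁ 2≤ns₁ ∘ sym ∘ index-injective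

  xy-totallyDominates : IsTDS K (x ∷ y ∷ [])
  xy-totallyDominates (i , _) with i ≟ zero
  ... | yes refl = y , there (here refl) , λ ()
  ... | no i≢0   = x , here refl , i≢0

  neighbour-away : ∀ v → ∃ λ w → K v w × w ≢ x × w ≢ y
  neighbour-away (i , _) with i ≟ zero
  ... | yes refl = y′ , (λ ()) , (λ ()) , y′≢y
  ... | no i≢0   = x′ , i≢0 , x′≢x , λ ()

  private
    module Isolated = IsolateEdge (≡-dec _≟_ _≟_) (KAdj? (suc (suc k)) ns)
                        (∈-vertices (suc (suc k)) ns) (vertices-unique (suc (suc k)) ns) x≢y

  open Isolated public using (cut; length-cut)

  cut-isTotalBondageSet : IsTotalBondageSet K cut
  cut-isTotalBondageSet = Isolated.isTotalBondageSet (λ ()) (λ ()) neighbour-away xy-totallyDominates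
                            {x′} (λ x′~x → x′~x refl) (λ ()) x′≢x

n+n≤4n∸2m∸2 : ∀ {m n} → m < n → n + n ≤ 4 * n ∸ 2 * m ∸ 2
n+n≤4n∸2m∸2 {m} {n} m<n = begin
  n + n               ≤⟨ m+n≤o⇒m≤o∸n (n + n) room ⟩
  4 * n ∸ (2 * m + 2) ≡⟨ ∸-+-assoc (4 * n) (2 * m) 2 ⟨
  4 * n ∸ 2 * m ∸ 2   ∎
  where
  open ≤-Reasoning
  room : n + n + (2 * m + 2) ≤ 4 * n
  room = begin
    n + n + (2 * m + 2) ≡⟨ cong (n + n +_) (trans (*-suc 2 m) (+-comm 2 (2 * m))) ⟨
    n + n + 2 * suc m   ≤⟨ +-monoʳ-≤ (n + n) (*-monoʳ-≤ 2 m<n) ⟩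
    n + n + 2 * n       ≡⟨ +-assoc n n (2 * n) ⟩
    4 * n               ∎

mainTheorem7 : (k : ℕ) (ns : Fin (suc (suc k)) → ℕ) →
    (∀ i j → i ≤ᶠ j → ns j ≤ ns i) →
    (∀ i → 2 ≤ ns i) →
    TotalBondageAtMost (KAdj (suc (suc k)) ns)
      (4 * numVertices (suc (suc k)) ns ∸ 2 * ns zero ∸ 2)
mainTheorem7 k ns _ 2≤ns = cut , cut-isTotalBondageSet , length-cut≤bound
  where
  open TwoLargeParts ns (2≤ns zero) (2≤ns (suc zero))
  n = numVertices (suc (suc k)) ns
  ns₀<n : ns zero < n
  ns₀<n = m<m+n (ns zero) (≤-trans (s≤s z≤n) (≤-trans (2≤ns (suc zero)) (m≤m+n _ _)))
  length-cut≤bound : length cut ≤ 4 * n ∸ 2 * ns zero ∸ 2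
  length-cut≤bound = begin
    length cut                                              ≤⟨ length-cut ⟩
    length (vertices _ ns) + length (vertices _ ns)         ≡⟨ cong₂ _+_ (length-vertices _ ns) (length-vertices _ ns) ⟩
    n + n                                                   ≤⟨ n+n≤4n∸2m∸2 ns₀<n ⟩
    4 * n ∸ 2 * ns zero ∸ 2                                 ∎
    where open ≤-Reasoning
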